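{- Let $p$ be a prime and $q=p^e$. Let $L_m(q)$ be the bipartite graph whose vertex set is the disjoint union of a point set $\mathbb{F}_q^{m+1}$ and a line set $\mathbb{F}_q^{m+1}$, with a point $P=(p_1,\dots,p_{m+1})$ adjacent to a line $L=[l_1,\dots,l_{m+1}]$ if and only if $l_k+p_k=p_1^{\,p^{k-2}}\,l_1$ for all $k=2,\dots,m+1$. Suppose either ($m\ge1$, $e\ge1$ and $p$ is odd) or ($m=1$, $e\ge2$ and $p=2$). Then the girth of $L_m(q)$ is $6$.
   Context: The girth is the length of a shortest cycle in the graph. -}

module Defs where

open import Level using (Level; _⊔_) renaming (suc to lsuc)
open import Algebra.Bundles using (CommutativeRing)
import Algebra.Bundles
import Algebra.Definitions.RawSemiring as RawSemiringDefs
open import Data.Nat using (ℕ; zero; suc; _<_; _≤_; _%_)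
open import Data.Nat.DivMod using (m%n<n)
open import Data.Fin using (Fin; toℕ; fromℕ<) renaming (suc to fsuc; zero to fzero)
open import Data.Product using (Σ; _×_; ∃)
open import Data.Sum using (_⊎_; inj₁; inj₂)
open import Data.Empty using (⊥)
import Data.Empty.Polymorphic
import Data.Nat
open import Data.Unit using (⊤)
open import Relation.Nullary using (¬_)
open import Relation.Binary.PropositionalEquality using (_≡_)

record FiniteField (c ℓ : Level) : Set (lsuc (c ⊔ ℓ)) where
  field
    commRing : CommutativeRing c ℓ
  open CommutativeRing commRing public
  field
    0≉1      : ¬ (0# ≈ 1#)
    inverse  : ∀ x → ¬ (x ≈ 0#) → Σ Carrier (λ y → (x * y) ≈ 1#)
    size     : ℕ
    enum     : Fin size → Carrier
    enum-surj : ∀ x → Σ (Fin size) (λ i → enum i ≈ x)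
    enum-inj  : ∀ i j → enum i ≈ enum j → i ≡ j
  open RawSemiringDefs (Algebra.Bundles.Semiring.rawSemiring semiring) public using (_^_)

record Graph (v e r : Level) : Set (lsuc (v ⊔ e ⊔ r)) where
  field
    Vertex : Set v
    _≈V_   : Vertex → Vertex → Set e
    Adj    : Vertex → Vertex → Set r

next : ∀ {k} → Fin (suc k) → Fin (suc k)
next {k} i = fromℕ< (m%n<n (suc (toℕ i)) (suc k))

record Cycle {v e r} (G : Graph v e r) (n : ℕ) : Set (v ⊔ e ⊔ r) where
  open Graph G
  field
    len≥3    : 3 ≤ n
    len-1    : ℕ
    len≡     : n ≡ suc len-1
    vert     : Fin (suc len-1) → Vertex
    distinct : ∀ i j → vert i ≈V vert j → i ≡ j
    adjacent : ∀ i → Adj (vert i) (vert (next i))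

HasGirth : ∀ {v e r} → Graph v e r → ℕ → Set (v ⊔ e ⊔ r)
HasGirth G g = Cycle G g × (∀ n → n < g → ¬ Cycle G n)

-- The graph L_m(q) over a finite field F (0-indexed coordinates:
-- coordinate i : Fin (suc m) is coordinate i+1 in the paper).

module _ {c ℓ} (F : FiniteField c ℓ) (p m : ℕ) where
  open FiniteField F

  Coords : Set c
  Coords = Fin (suc m) → Carrier

  -- P = (p₁,…,p_{m+1}) incident with L = [l₁,…,l_{m+1}] iff
  -- l_k + p_k = p₁^(p^(k-2)) l₁ for k = 2,…,m+1
  -- (here k = j + 2 for j : Fin m, i.e. coordinate index fsuc j).
  Incident : Coords → Coords → Set ℓ
  Incident P L = ∀ (j : Fin m) →
    (L (fsuc j) + P (fsuc j)) ≈ ((P fzero ^ (p Data.Nat.^ toℕ j)) * L fzero)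

  -- vertices: inj₁ = points, inj₂ = lines
  LVertex : Set c
  LVertex = Coords ⊎ Coords

  _≈L_ : LVertex → LVertex → Set ℓ
  inj₁ P ≈L inj₁ Q = ∀ i → P i ≈ Q i
  inj₂ L ≈L inj₂ K = ∀ i → L i ≈ K i
  inj₁ _ ≈L inj₂ _ = Data.Empty.Polymorphic.⊥
  inj₂ _ ≈L inj₁ _ = Data.Empty.Polymorphic.⊥

  LAdj : LVertex → LVertex → Set ℓ
  LAdj (inj₁ P) (inj₂ L) = Incident P L
  LAdj (inj₂ L) (inj₁ P) = Incident P L
  LAdj (inj₁ _) (inj₁ _) = Data.Empty.Polymorphic.⊥
  LAdj (inj₂ _) (inj₂ _) = Data.Empty.Polymorphic.⊥

  LGraph : Graph c ℓ ℓ
  LGraph = record { Vertex = LVertex ; _≈V_ = _≈L_ ; Adj = LAdj }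

-- L_m(q) is bipartite, so it has no cycles of length 3 or 5. It has no
-- 4-cycles: for a point P on lines L and K, subtracting the k = 2
-- incidence equations gives L₂ - K₂ = P₁ (L₁ - K₁), and L₁ ≠ K₁ since a
-- point and a first coordinate determine a line; so P₁, and with it P,
-- is determined by L and K. For every t ∉ {0, 1} with t^(p^j) = t for all
-- j, the points (0,0,…), (1,t,…), (t,t,…) and lines [t,0,…], [0,-t,…],
-- [1,0,…] form a hexagon. For odd p take t = -1, which differs from 1
-- because otherwise x ↦ x + 1 would be a fixed-point-free involution of a
-- field of odd order; for p = 2 and m = 1 only t^1 = t is required, and
-- q ≥ 4 leaves room for t.
module Submission where

open import Defs
open import Data.Nat using (ℕ; zero; suc; _^_; _≤_; _<_; _%_; NonZero; z≤n; s≤s)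
open import Data.Nat.Divisibility using (_∣_; divides; n∣m⇒m%n≡0)
open import Data.Nat.DivMod using (%-distribˡ-*)
open import Data.Nat.Primality using (Prime)
open import Data.Nat.Properties using (+-0-commutativeMonoid; ≤-trans; ^-monoʳ-≤; m^n≢0)
open import Data.Bool using (Bool; true; false; not; if_then_else_)
open import Data.Bool.Properties using (not-¬; not-involutive)
open import Data.Fin as Fin using (Fin; toℕ; combine; remQuot)
open import Data.Fin.Patterns using (0F; 1F; 2F; 3F; 4F; 5F)
open import Data.Fin.Properties using (_<?_; <-cmp; combine-remQuot)
import Data.Fin.Permutation as Perm
open import Algebra.Properties.CommutativeMonoid.Sum +-0-commutativeMonoid
  using (sum; sum-cong-≗; ∑-distrib-+; sum-permute)
open import Data.Product using (∃; _×_; _,_; proj₁; proj₂; uncurry)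
open import Data.Sum using (_⊎_; inj₁; inj₂)
open import Data.Empty using (⊥)
open import Function using (_∘_)
open import Relation.Binary.Definitions using (tri<; tri≈; tri>)
open import Relation.Nullary using (¬_; does)
open import Relation.Nullary.Decidable using (dec-true; dec-false)
open import Relation.Nullary.Negation using (contradiction)
import Relation.Binary.PropositionalEquality as ≡
open ≡ using (_≡_; _≢_; cong; cong₂; module ≡-Reasoning)

module _ where
  open import Data.Nat using (_+_; _*_)
  open import Data.Nat.Properties using (*-comm; +-identityʳ)

  ^-odd : ∀ {p} n → p % 2 ≡ 1 → p ^ n % 2 ≡ 1
  ^-odd zero    _     = ≡.refl
  ^-odd {p} (suc n) p-odd = begin
    p * p ^ n % 2                 ≡⟨ %-distribˡ-* p (p ^ n) 2 ⟩
    (p % 2) * (p ^ n % 2) % 2     ≡⟨ cong₂ (λ a b → a * b % 2) p-odd (^-odd n p-odd) ⟩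
    1                             ∎
    where open ≡-Reasoning

  odd⇒nonZero : ∀ {n} → n % 2 ≡ 1 → NonZero n
  odd⇒nonZero {suc _} _ = _

  [_<_] : ∀ {n} → Fin n → Fin n → ℕ
  [ i < j ] = if does (i <? j) then 1 else 0

  [<]+[>]≡1 : ∀ {n} {i j : Fin n} → i ≢ j → [ i < j ] + [ j < i ] ≡ 1
  [<]+[>]≡1 {i = i} {j} i≢j with <-cmp i j
  ... | tri< i<j _ j≮i rewrite dec-true (i <? j) i<j | dec-false (j <? i) j≮i = ≡.refl
  ... | tri≈ _ i≡j _   = contradiction i≡j i≢j
  ... | tri> i≮j _ j<i rewrite dec-false (i <? j) i≮j | dec-true (j <? i) j<i = ≡.refl

  sum-ones : ∀ n → sum {n} (λ _ → 1) ≡ n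
  sum-ones zero    = ≡.refl
  sum-ones (suc n) = cong suc (sum-ones n)

  -- Each orbit {i, σ i} contains exactly one i with i < σ i, so n is twice
  -- the number of such i.
  fixedPointFreeInvolution⇒even : ∀ {n} (σ : Fin n → Fin n) →
    (∀ i → σ (σ i) ≡ i) → (∀ i → σ i ≢ i) → 2 ∣ n
  fixedPointFreeInvolution⇒even {n} σ σ-involutive σ-fixedPointFree =
    divides (sum ascends) (begin
      n                                       ≡⟨ sum-ones n ⟨
      sum {n} (λ _ → 1)                       ≡⟨ sum-cong-≗ (≡.sym ∘ orbit-ascends-once) ⟩
      sum (λ i → ascends i + ascends (σ i))   ≡⟨ ∑-distrib-+ ascends (ascends ∘ σ) ⟩
      sum ascends + sum (ascends ∘ σ)         ≡⟨ cong (sum ascends +_) (sum-permute ascends σ̂) ⟨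
      sum ascends + sum ascends               ≡⟨ cong (sum ascends +_) (+-identityʳ (sum ascends)) ⟨
      2 * sum ascends                         ≡⟨ *-comm 2 (sum ascends) ⟩
      sum ascends * 2                         ∎)
    where
    open ≡-Reasoning
    ascends : Fin n → ℕ
    ascends i = [ i < σ i ]
    orbit-ascends-once : ∀ i → ascends i + ascends (σ i) ≡ 1
    orbit-ascends-once i rewrite σ-involutive i = [<]+[>]≡1 (σ-fixedPointFree i ∘ ≡.sym)
    σ̂ : Perm.Permutation n n
    σ̂ = Perm.permutation σ σ (λ _ → σ-involutive _) (λ _ → σ-involutive _)

  avoid-two : ∀ {n} → 3 ≤ n → (i j : Fin n) → ∃ λ k → k ≢ i × k ≢ j
  avoid-two (s≤s (s≤s (s≤s _))) 0F 0F = 1F , (λ ()) , (λ ())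
  avoid-two (s≤s (s≤s (s≤s _))) 0F 1F = 2F , (λ ()) , (λ ())
  avoid-two (s≤s (s≤s (s≤s _))) 0F (Fin.suc (Fin.suc _)) = 1F , (λ ()) , (λ ())
  avoid-two (s≤s (s≤s (s≤s _))) 1F 0F = 2F , (λ ()) , (λ ())
  avoid-two (s≤s (s≤s (s≤s _))) 1F (Fin.suc _) = 0F , (λ ()) , (λ ())
  avoid-two (s≤s (s≤s (s≤s _))) (Fin.suc (Fin.suc _)) 0F = 1F , (λ ()) , (λ ())
  avoid-two (s≤s (s≤s (s≤s _))) (Fin.suc (Fin.suc _)) (Fin.suc _) = 0F , (λ ()) , (λ ())

module FiniteFieldProperties {c ℓ} (F : FiniteField c ℓ) where
  open FiniteField F renaming (_^_ to _^ᶠ_)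
  open import Algebra.Properties.Ring ring
    using (-1*x≈-x; -‿involutive; -0#≈0#; +-cancelˡ; -‿+-comm)
  open import Algebra.Properties.CommutativeSemigroup +-commutativeSemigroup using (interchange)
  open import Relation.Binary.Reasoning.Setoid setoid

  index : Carrier → Fin size
  index x = proj₁ (enum-surj x)

  enum-index : ∀ x → enum (index x) ≈ x
  enum-index x = proj₂ (enum-surj x)

  1≉0 : ¬ 1# ≈ 0#
  1≉0 = 0≉1 ∘ sym

  -1≉0 : ¬ - 1# ≈ 0#
  -1≉0 -1≈0 = 1≉0 (begin
    1#        ≈⟨ -‿involutive 1# ⟨
    - (- 1#)  ≈⟨ -‿cong -1≈0 ⟩
    - 0#      ≈⟨ -0#≈0# ⟩
    0#        ∎)

  *-cancelʳ-nonZero : ∀ {x y d} → ¬ d ≈ 0# → x * d ≈ y * d → x ≈ y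
  *-cancelʳ-nonZero {x} {y} {d} d≉0 xd≈yd = begin
    x                ≈⟨ *-identityʳ x ⟨
    x * 1#           ≈⟨ *-congˡ d*d⁻¹≈1 ⟨
    x * (d * d⁻¹)    ≈⟨ *-assoc x d d⁻¹ ⟨
    (x * d) * d⁻¹    ≈⟨ *-congʳ xd≈yd ⟩
    (y * d) * d⁻¹    ≈⟨ *-assoc y d d⁻¹ ⟩
    y * (d * d⁻¹)    ≈⟨ *-congˡ d*d⁻¹≈1 ⟩
    y * 1#           ≈⟨ *-identityʳ y ⟩
    y                ∎
    where
    d⁻¹ = proj₁ (inverse d d≉0)
    d*d⁻¹≈1 = proj₂ (inverse d d≉0)

  x+z≈a∧y+z≈b⇒x-y≈a-b : ∀ {x y z a b} → x + z ≈ a → y + z ≈ b → x - y ≈ a - b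
  x+z≈a∧y+z≈b⇒x-y≈a-b {x} {y} {z} {a} {b} x+z≈a y+z≈b = begin
    x - y                ≈⟨ +-identityʳ (x - y) ⟨
    (x - y) + 0#         ≈⟨ +-congˡ (-‿inverseʳ z) ⟨
    (x - y) + (z - z)    ≈⟨ interchange x z (- y) (- z) ⟨
    (x + z) + (- y - z)  ≈⟨ +-congˡ (-‿+-comm y z) ⟩
    (x + z) - (y + z)    ≈⟨ +-cong x+z≈a (-‿cong y+z≈b) ⟩
    a - b                ∎

  0^n≈0 : ∀ n → .{{NonZero n}} → 0# ^ᶠ n ≈ 0#
  0^n≈0 (suc n) = zeroˡ _

  1^n≈1 : ∀ n → 1# ^ᶠ n ≈ 1#
  1^n≈1 zero    = refl
  1^n≈1 (suc n) = trans (*-identityˡ _) (1^n≈1 n)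

  x²≈1⇒x^odd≈x : ∀ {x} n → x * x ≈ 1# → n % 2 ≡ 1 → x ^ᶠ n ≈ x
  x²≈1⇒x^odd≈x             1                   _    _     = *-identityʳ _
  x²≈1⇒x^odd≈x {x} (suc (suc n)) x²≈1 n-odd = begin
    x * (x * x ^ᶠ n)  ≈⟨ *-assoc x x _ ⟨
    (x * x) * x ^ᶠ n  ≈⟨ *-cong x²≈1 (x²≈1⇒x^odd≈x n x²≈1 n-odd) ⟩
    1# * x            ≈⟨ *-identityˡ x ⟩
    x                 ∎

  characteristic2⇒2∣size : 1# + 1# ≈ 0# → 2 ∣ size
  characteristic2⇒2∣size 1+1≈0 =
    fixedPointFreeInvolution⇒even shift shift-involutive shift-fixedPointFree
    where
    shift : Fin size → Fin size
    shift i = index (enum i + 1#)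
    shift-involutive : ∀ i → shift (shift i) ≡ i
    shift-involutive i = enum-inj _ _ (begin
      enum (shift (shift i))  ≈⟨ enum-index _ ⟩
      enum (shift i) + 1#     ≈⟨ +-congʳ (enum-index _) ⟩
      (enum i + 1#) + 1#      ≈⟨ +-assoc _ _ _ ⟩
      enum i + (1# + 1#)      ≈⟨ +-congˡ 1+1≈0 ⟩
      enum i + 0#             ≈⟨ +-identityʳ _ ⟩
      enum i                  ∎)
    shift-fixedPointFree : ∀ i → shift i ≢ i
    shift-fixedPointFree i shift-i≡i = 1≉0 (+-cancelˡ (enum i) 1# 0# (begin
      enum i + 1#     ≈⟨ enum-index _ ⟨
      enum (shift i)  ≡⟨ cong enum shift-i≡i ⟩
      enum i          ≈⟨ +-identityʳ _ ⟨
      enum i + 0#     ∎))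

  oddSize⇒-1≉1 : size % 2 ≡ 1 → ¬ - 1# ≈ 1#
  oddSize⇒-1≉1 size-odd -1≈1 =
    contradiction (≡.trans (≡.sym (n∣m⇒m%n≡0 size 2 (characteristic2⇒2∣size 1+1≈0))) size-odd)
                  λ ()
    where
    1+1≈0 : 1# + 1# ≈ 0#
    1+1≈0 = trans (+-congˡ (sym -1≈1)) (-‿inverseʳ 1#)

  [-1]²≈1 : - 1# * - 1# ≈ 1#
  [-1]²≈1 = trans (-1*x≈-x (- 1#)) (-‿involutive 1#)

  ∃≉0∧≉1 : 3 ≤ size → ∃ λ t → ¬ t ≈ 0# × ¬ t ≈ 1#
  ∃≉0∧≉1 3≤size with k , k≢i0 , k≢i1 ← avoid-two 3≤size (index 0#) (index 1#) =
    enum k , (λ t≈0 → k≢i0 (enum-inj _ _ (trans t≈0 (sym (enum-index 0#)))))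
           , (λ t≈1 → k≢i1 (enum-inj _ _ (trans t≈1 (sym (enum-index 1#)))))

  triple : Carrier → Carrier → Carrier → Fin 3 → Carrier
  triple a _ _ 0F = a
  triple _ b _ 1F = b
  triple _ _ c 2F = c

  triple-injective : ∀ {a b c} → ¬ a ≈ b → ¬ a ≈ c → ¬ b ≈ c →
                     ∀ i j → triple a b c i ≈ triple a b c j → i ≡ j
  triple-injective a≉b a≉c b≉c 0F 0F _ = ≡.refl
  triple-injective a≉b a≉c b≉c 0F 1F a≈b = contradiction a≈b a≉b
  triple-injective a≉b a≉c b≉c 0F 2F a≈c = contradiction a≈c a≉c
  triple-injective a≉b a≉c b≉c 1F 0F b≈a = contradiction (sym b≈a) a≉b
  triple-injective a≉b a≉c b≉c 1F 1F _ = ≡.refl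
  triple-injective a≉b a≉c b≉c 1F 2F b≈c = contradiction b≈c b≉c
  triple-injective a≉b a≉c b≉c 2F 0F c≈a = contradiction (sym c≈a) a≉c
  triple-injective a≉b a≉c b≉c 2F 1F c≈b = contradiction (sym c≈b) b≉c
  triple-injective a≉b a≉c b≉c 2F 2F _ = ≡.refl

module Girth {c ℓ} (F : FiniteField c ℓ) (p m-1 : ℕ) where
  open FiniteField F renaming (_^_ to _^ᶠ_)
  open FiniteFieldProperties F
  open import Algebra.Properties.Ring ring using (+-cancelˡ; +-cancelʳ; x∙y⁻¹≈ε⇒x≈y; x[y-z]≈xy-xz)
  open import Algebra.Properties.Semiring.Exp semiring using (^-congˡ)

  G : Graph c ℓ ℓ
  G = LGraph F p (suc m-1)

  Point Line : Set c
  Point = Coords F p (suc m-1)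
  Line  = Coords F p (suc m-1)

  _≋_ : Coords F p (suc m-1) → Coords F p (suc m-1) → Set ℓ
  P ≋ Q = ∀ i → P i ≈ Q i

  _∈_ : Point → Line → Set ℓ
  _∈_ = Incident F p (suc m-1)

  -- The equation for k = 2 has exponent p⁰ = 1, so it is linear in P.
  ∈⇒first-equation : ∀ {P L} → P ∈ L → L 1F + P 1F ≈ P 0F * L 0F
  ∈⇒first-equation P∈L = trans (P∈L 0F) (*-congʳ (*-identityʳ _))

  slope : ∀ {P L K} → P ∈ L → P ∈ K → L 1F - K 1F ≈ P 0F * (L 0F - K 0F)
  slope {P} {L} {K} P∈L P∈K = begin
    L 1F - K 1F                  ≈⟨ x+z≈a∧y+z≈b⇒x-y≈a-b (∈⇒first-equation {P} {L} P∈L)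
                                                          (∈⇒first-equation {P} {K} P∈K) ⟩
    P 0F * L 0F - P 0F * K 0F    ≈⟨ x[y-z]≈xy-xz (P 0F) (L 0F) (K 0F) ⟨
    P 0F * (L 0F - K 0F)         ∎
    where open import Relation.Binary.Reasoning.Setoid setoid

  line-determined-by-0 : ∀ {P L K} → P ∈ L → P ∈ K → L 0F ≈ K 0F → L ≋ K
  line-determined-by-0 P∈L P∈K L₀≈K₀ 0F = L₀≈K₀
  line-determined-by-0 {P} {L} {K} P∈L P∈K L₀≈K₀ (Fin.suc j) =
    +-cancelʳ (P (Fin.suc j)) _ _ (trans (P∈L j) (trans (*-congˡ L₀≈K₀) (sym (P∈K j))))

  point-determined-by-0 : ∀ {P Q L} → P ∈ L → Q ∈ L → P 0F ≈ Q 0F → P ≋ Q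
  point-determined-by-0 P∈L Q∈L P₀≈Q₀ 0F = P₀≈Q₀
  point-determined-by-0 {L = L} P∈L Q∈L P₀≈Q₀ (Fin.suc j) =
    +-cancelˡ (L (Fin.suc j)) _ _
      (trans (P∈L j) (trans (*-congʳ (^-congˡ (p ^ toℕ j) P₀≈Q₀)) (sym (Q∈L j))))

  two-lines-meet-once : ∀ {P Q L K} → P ∈ L → Q ∈ L → P ∈ K → Q ∈ K → ¬ L ≋ K → P ≋ Q
  two-lines-meet-once {P} {Q} {L} {K} P∈L Q∈L P∈K Q∈K L≉K =
    point-determined-by-0 {P} {Q} {L} P∈L Q∈L
      (*-cancelʳ-nonZero L₀-K₀≉0
        (trans (sym (slope {P} {L} {K} P∈L P∈K)) (slope {Q} {L} {K} Q∈L Q∈K)))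
    where
    L₀-K₀≉0 : ¬ L 0F - K 0F ≈ 0#
    L₀-K₀≉0 = L≉K ∘ line-determined-by-0 {P} {L} {K} P∈L P∈K ∘ x∙y⁻¹≈ε⇒x≈y _ _

  open Graph G using (Vertex; Adj; _≈V_)

  side : Vertex → Bool
  side (inj₁ _) = true
  side (inj₂ _) = false

  Adj⇒side-flips : ∀ {x y} → Adj x y → side y ≡ not (side x)
  Adj⇒side-flips {inj₁ _} {inj₂ _} _ = ≡.refl
  Adj⇒side-flips {inj₂ _} {inj₁ _} _ = ≡.refl

  no-3-cycle : ¬ Cycle G 3
  no-3-cycle record { len≡ = ≡.refl ; vert = v ; adjacent = adj } = not-¬ ≡.refl (begin
    side (v 0F)                    ≡⟨ Adj⇒side-flips (adj 2F) ⟩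
    not (side (v 2F))              ≡⟨ cong not (Adj⇒side-flips (adj 1F)) ⟩
    not (not (side (v 1F)))        ≡⟨ not-involutive _ ⟩
    side (v 1F)                    ≡⟨ Adj⇒side-flips (adj 0F) ⟩
    not (side (v 0F))              ∎)
    where open ≡-Reasoning

  no-5-cycle : ¬ Cycle G 5
  no-5-cycle record { len≡ = ≡.refl ; vert = v ; adjacent = adj } = not-¬ ≡.refl (begin
    side (v 0F)                    ≡⟨ Adj⇒side-flips (adj 4F) ⟩
    not (side (v 4F))              ≡⟨ cong not (Adj⇒side-flips (adj 3F)) ⟩
    not (not (side (v 3F)))        ≡⟨ not-involutive _ ⟩
    side (v 3F)                    ≡⟨ Adj⇒side-flips (adj 2F) ⟩
    not (side (v 2F))              ≡⟨ cong not (Adj⇒side-flips (adj 1F)) ⟩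
    not (not (side (v 1F)))        ≡⟨ not-involutive _ ⟩
    side (v 1F)                    ≡⟨ Adj⇒side-flips (adj 0F) ⟩
    not (side (v 0F))              ∎)
    where open ≡-Reasoning

  no-quadrilateral : ∀ {a b c d} → Adj a b → Adj b c → Adj c d → Adj d a →
                     ¬ a ≈V c → ¬ b ≈V d → ⊥
  no-quadrilateral {inj₁ P} {inj₂ L} {inj₁ Q} {inj₂ K} P∈L Q∈L Q∈K P∈K P≉Q L≉K =
    P≉Q (two-lines-meet-once {P} {Q} {L} {K} P∈L Q∈L P∈K Q∈K L≉K)
  no-quadrilateral {inj₂ L} {inj₁ P} {inj₂ K} {inj₁ Q} P∈L P∈K Q∈K Q∈L L≉K P≉Q =
    P≉Q (two-lines-meet-once {P} {Q} {L} {K} P∈L Q∈L P∈K Q∈K L≉K)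

  no-4-cycle : ¬ Cycle G 4
  no-4-cycle record { len≡ = ≡.refl ; distinct = distinct ; adjacent = adj } =
    no-quadrilateral (adj 0F) (adj 1F) (adj 2F) (adj 3F)
      (λ v₀≈v₂ → contradiction (distinct 0F 2F v₀≈v₂) λ ())
      (λ v₁≈v₃ → contradiction (distinct 1F 3F v₁≈v₃) λ ())

  no-cycle-shorter-than-6 : ∀ n → n < 6 → ¬ Cycle G n
  no-cycle-shorter-than-6 3 _ = no-3-cycle
  no-cycle-shorter-than-6 4 _ = no-4-cycle
  no-cycle-shorter-than-6 5 _ = no-5-cycle
  no-cycle-shorter-than-6 0 _ record { len≥3 = () }
  no-cycle-shorter-than-6 1 _ record { len≥3 = s≤s () }
  no-cycle-shorter-than-6 2 _ record { len≥3 = s≤s (s≤s ()) }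
  no-cycle-shorter-than-6 (suc (suc (suc (suc (suc (suc _)))))) (s≤s (s≤s (s≤s (s≤s (s≤s (s≤s ())))))) _

  coords : Carrier → Carrier → Coords F p (suc m-1)
  coords a _ 0F          = a
  coords _ b (Fin.suc _) = b

  FrobeniusFixed : Carrier → Set ℓ
  FrobeniusFixed a = ∀ (j : Fin (suc m-1)) → a ^ᶠ (p ^ toℕ j) ≈ a

  ∈-coords : ∀ {a b c d} → FrobeniusFixed a → d + b ≈ a * c → coords a b ∈ coords c d
  ∈-coords a-fixed d+b≈ac j = trans d+b≈ac (*-congʳ (sym (a-fixed j)))

  module Hexagon (t : Carrier) (t≉0 : ¬ t ≈ 0#) (t≉1 : ¬ t ≈ 1#) (t-fixed : FrobeniusFixed t)
                 .{{_ : NonZero p}} where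

    0-fixed : FrobeniusFixed 0#
    0-fixed j = 0^n≈0 (p ^ toℕ j) {{m^n≢0 p (toℕ j)}}

    1-fixed : FrobeniusFixed 1#
    1-fixed j = 1^n≈1 (p ^ toℕ j)

    -- Vertex 2k + s of the hexagon; line k meets points k and k + 1.
    hexagon-vertex : Fin 3 × Fin 2 → Vertex
    hexagon-vertex (k , 0F) = inj₁ (coords (triple 0# 1# t k) (triple 0# t t k))
    hexagon-vertex (k , 1F) = inj₂ (coords (triple t 0# 1# k) (triple 0# (- t) 0# k))

    hexagon-vertex-injective : ∀ x y → hexagon-vertex x ≈V hexagon-vertex y → x ≡ y
    hexagon-vertex-injective (k , 0F) (l , 0F) same =
      cong (_, 0F) (triple-injective 0≉1 (t≉0 ∘ sym) (t≉1 ∘ sym) k l (same 0F))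
    hexagon-vertex-injective (k , 1F) (l , 1F) same =
      cong (_, 1F) (triple-injective t≉0 t≉1 0≉1 k l (same 0F))
    hexagon-vertex-injective (_ , 0F) (_ , 1F) ()
    hexagon-vertex-injective (_ , 1F) (_ , 0F) ()

    vertex : Fin 6 → Vertex
    vertex = hexagon-vertex ∘ remQuot {3} 2

    adjacent : ∀ i → Adj (vertex i) (vertex (next i))
    adjacent 0F = ∈-coords 0-fixed (trans (+-identityˡ 0#) (sym (zeroˡ t)))
    adjacent 1F = ∈-coords 1-fixed (trans (+-identityˡ t) (sym (*-identityˡ t)))
    adjacent 2F = ∈-coords 1-fixed (trans (-‿inverseˡ t) (sym (zeroʳ 1#)))
    adjacent 3F = ∈-coords t-fixed (trans (-‿inverseˡ t) (sym (zeroʳ t)))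
    adjacent 4F = ∈-coords t-fixed (trans (+-identityˡ t) (sym (*-identityʳ t)))
    adjacent 5F = ∈-coords 0-fixed (trans (+-identityˡ 0#) (sym (zeroˡ 1#)))

    distinct : ∀ i j → vertex i ≈V vertex j → i ≡ j
    distinct i j same = begin
      i                                   ≡⟨ combine-remQuot {3} 2 i ⟨
      uncurry combine (remQuot {3} 2 i)   ≡⟨ cong (uncurry combine) (hexagon-vertex-injective _ _ same) ⟩
      uncurry combine (remQuot {3} 2 j)   ≡⟨ combine-remQuot {3} 2 j ⟩
      j                                   ∎
      where open ≡-Reasoning

    hexagon : Cycle G 6
    hexagon = record { len≥3 = s≤s (s≤s (s≤s z≤n)) ; len-1 = 5 ; len≡ = ≡.refl
                     ; vert = vertex ; distinct = distinct ; adjacent = adjacent }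

  girth6 : (t : Carrier) → ¬ t ≈ 0# → ¬ t ≈ 1# → FrobeniusFixed t → .{{NonZero p}} → HasGirth G 6
  girth6 t t≉0 t≉1 t-fixed = Hexagon.hexagon t t≉0 t≉1 t-fixed , no-cycle-shorter-than-6

3≤2^e : ∀ {e} → 2 ≤ e → 3 ≤ 2 ^ e
3≤2^e 2≤e = ≤-trans (s≤s (s≤s (s≤s z≤n))) (^-monoʳ-≤ 2 2≤e)

theorem5p3 : ∀ {c ℓ} (p e m : ℕ) → Prime p → (F : FiniteField c ℓ) →
    FiniteField.size F ≡ p ^ e →
    ((1 ≤ m × 1 ≤ e × p % 2 ≡ 1) ⊎ (m ≡ 1 × 2 ≤ e × p ≡ 2)) →
    HasGirth (LGraph F p m) 6
theorem5p3 p e (suc m-1) _ F size≡pᵉ (inj₁ (_ , _ , p-odd)) =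
  girth6 (- 1#) -1≉0 (oddSize⇒-1≉1 size-odd) -1-fixed {{odd⇒nonZero p-odd}}
  where
  open FiniteField F using (size; 1#; -_)
  open FiniteFieldProperties F
  open Girth F p m-1
  size-odd : size % 2 ≡ 1
  size-odd = ≡.trans (cong (_% 2) size≡pᵉ) (^-odd e p-odd)
  -1-fixed : FrobeniusFixed (- 1#)
  -1-fixed j = x²≈1⇒x^odd≈x (p ^ toℕ j) [-1]²≈1 (^-odd (toℕ j) p-odd)
theorem5p3 .2 e .1 _ F size≡2ᵉ (inj₂ (≡.refl , 2≤e , ≡.refl))
  with t , t≉0 , t≉1 ← FiniteFieldProperties.∃≉0∧≉1 F (≡.subst (3 ≤_) (≡.sym size≡2ᵉ) (3≤2^e 2≤e)) =
  girth6 t t≉0 t≉1 λ { 0F → *-identityʳ t }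
  where
  open FiniteField F using (*-identityʳ)
  open Girth F 2 0
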